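{- In a graph $G$ with $\mu_\alpha(G)\leq 1$, every internal vertex is adjacent to at most two leaves.
   Context: All graphs are finite and simple. For a graph $G$, $\alpha(G)$ is the maximum size of an independent set, $i(G)$ is the minimum size of an inclusion-maximal independent set, and $\mu_\alpha(G)=\alpha(G)-i(G)$. Let $U$ be the set of vertices whose connected component in $G$ is a complete graph; in $G-U$, a leaf is a vertex of degree $1$ and an internal vertex is a vertex of $G-U$ that is not a leaf. -}

module Defs where

open import Data.Nat using (ℕ; _∸_; _≤_)
open import Data.Fin using (Fin)
open import Data.Fin.Subset using (Subset; _∈_; _∉_; ∣_∣)
open import Data.Product using (Σ; _×_; ∃)
open import Relation.Binary.PropositionalEquality using (_≡_; _≢_)
open import Relation.Nullary using (¬_)
open import Function.Bundles using (_⇔_)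

record Graph (n : ℕ) : Set₁ where
  field
    Adj    : Fin n → Fin n → Set
    sym    : ∀ {x y} → Adj x y → Adj y x
    irrefl : ∀ {x} → ¬ Adj x x

module _ {n : ℕ} (G : Graph n) where
  open Graph G

  Independent : Subset n → Set
  Independent S = ∀ x y → x ∈ S → y ∈ S → ¬ Adj x y

  MaximalIndependent : Subset n → Set
  MaximalIndependent S =
    Independent S × (∀ v → v ∉ S → Σ (Fin n) λ u → u ∈ S × Adj v u)

  IsAlpha : ℕ → Set
  IsAlpha k = (Σ (Subset n) λ S → Independent S × ∣ S ∣ ≡ k)
            × (∀ S → Independent S → ∣ S ∣ ≤ k)

  IsI : ℕ → Set
  IsI k = (Σ (Subset n) λ S → MaximalIndependent S × ∣ S ∣ ≡ k)
        × (∀ S → MaximalIndependent S → k ≤ ∣ S ∣)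

  MuAlphaAtMostOne : Set
  MuAlphaAtMostOne = ∀ a b → IsAlpha a → IsI b → a ∸ b ≤ 1

  data Reach : Fin n → Fin n → Set where
    here : ∀ {x} → Reach x x
    step : ∀ {x y z} → Adj x y → Reach y z → Reach x z

  -- v ∈ U: the connected component of v is a complete graph
  InU : Fin n → Set
  InU v = ∀ x y → Reach v x → Reach v y → x ≢ y → Adj x y

  -- degree of v in G - U equals d (for v a vertex of G - U)
  DegreeMinusU : Fin n → ℕ → Set
  DegreeMinusU v d = Σ (Subset n) λ N →
    (∀ x → (x ∈ N) ⇔ (Adj v x × ¬ InU x)) × ∣ N ∣ ≡ d

  Leaf : Fin n → Set
  Leaf v = ¬ InU v × DegreeMinusU v 1

  Internal : Fin n → Set
  Internal v = ¬ InU v × ¬ Leaf v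

module Submission where

-- Let J be a maximum independent set of G − N[v], v ∉ U. Then J ∪ {v} is a maximal
-- independent set, so i(G) ≤ |J| + 1. A leaf x adjacent to v has v as its only neighbour
-- (all neighbours of x lie outside U, and x has just one such), so J ∪ L is independent
-- and |J| + |L| ≤ α(G). Hence |L| ≤ μ_α(G) + 1 ≤ 2.
-- Adjacency is not assumed decidable, but the conclusion is, so decidability of adjacency
-- (which holds up to double negation on a finite vertex set) may be assumed.

open import Defs
open import Data.Nat using (ℕ; suc; _+_; _∸_; _≤_; _<_; _≤?_; s≤s; z≤n)
open import Data.Nat.Properties
  using (+-suc; +-identityʳ; +-cancelˡ-≤; +-monoˡ-≤; +-assoc; m≤m+n; m<m+n; m≤n+m∸n; <⇒≱; ≤-trans; ≤-totalOrder; module ≤-Reasoning)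
open import Data.Fin using (Fin; zero; suc; _≟_)
open import Data.Fin.Properties using (any?; all?)
open import Data.Fin.Subset using (Subset; inside; outside; _∈_; _∉_; _∪_; _∩_; _─_; ⁅_⁆; ∣_∣; Empty)
  renaming (⊥ to ∅)
open import Data.Fin.Subset.Properties
  using (_∈?_; ∉⊥; ∣⊥∣≡0; x∈⁅x⁆; x∈⁅y⁆⇒x≡y; ∣⁅x⁆∣≡1; x∈p∪q⁻; x∈p∪q⁺; x∈p∩q⁺; x∈p∩q⁻; Empty-unique; p⊆q⇒∣p∣≤∣q∣; p∩q≢∅⇒∣p─q∣<∣p∣; x∈p∧x≢y⇒x∈p-y)
open import Data.List using (List; [_]; _++_; map; filter)
open import Data.List.Membership.Propositional using () renaming (_∈_ to _∈ˡ_)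
open import Data.List.Membership.Propositional.Properties using (∈-map⁺; ∈-++⁺ˡ; ∈-++⁺ʳ; ∈-filter⁺)
open import Data.List.Relation.Unary.All as All using ()
open import Data.List.Relation.Unary.All.Properties using (all-filter)
open import Data.List.Relation.Unary.Any using (here)
open import Data.List.Extrema ≤-totalOrder using (argmax; argmin; argmax-all; argmin-all; f[xs]≤f[argmax]; f[argmin]≤f[xs])
open import Data.Product using (Σ-syntax; ∃; _×_; _,_; proj₁; proj₂)
open import Data.Sum using (inj₁; inj₂)
open import Data.Unit using (⊤; tt)
open import Data.Vec using ([]; _∷_)
open import Function using (_∘_)
open import Function.Bundles using (Equivalence)
open import Level using (Level; 0ℓ)
open import Relation.Binary.PropositionalEquality using (_≡_; _≢_; refl; sym; trans; cong; subst; module ≡-Reasoning)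
open import Relation.Nullary using (¬_; Dec; yes; no; contradiction)
open import Relation.Nullary.Negation using (¬¬-map)
open import Relation.Nullary.Decidable using (¬?; _×-dec_; _→-dec_; decidable-stable; ¬¬-excluded-middle)
open import Relation.Unary using (Pred; Decidable)

private
  variable
    n : ℕ
    p q : Subset n
    x y : Fin n

∣p∪q∣+∣p∩q∣≡∣p∣+∣q∣ : ∀ (p q : Subset n) → ∣ p ∪ q ∣ + ∣ p ∩ q ∣ ≡ ∣ p ∣ + ∣ q ∣
∣p∪q∣+∣p∩q∣≡∣p∣+∣q∣ []            []            = refl
∣p∪q∣+∣p∩q∣≡∣p∣+∣q∣ (outside ∷ p) (outside ∷ q) = ∣p∪q∣+∣p∩q∣≡∣p∣+∣q∣ p q
∣p∪q∣+∣p∩q∣≡∣p∣+∣q∣ (outside ∷ p) (inside  ∷ q) =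
  trans (cong suc (∣p∪q∣+∣p∩q∣≡∣p∣+∣q∣ p q)) (sym (+-suc ∣ p ∣ ∣ q ∣))
∣p∪q∣+∣p∩q∣≡∣p∣+∣q∣ (inside  ∷ p) (outside ∷ q) = cong suc (∣p∪q∣+∣p∩q∣≡∣p∣+∣q∣ p q)
∣p∪q∣+∣p∩q∣≡∣p∣+∣q∣ (inside  ∷ p) (inside  ∷ q) = cong suc (begin
  ∣ p ∪ q ∣ + suc ∣ p ∩ q ∣ ≡⟨ +-suc ∣ p ∪ q ∣ ∣ p ∩ q ∣ ⟩
  suc (∣ p ∪ q ∣ + ∣ p ∩ q ∣) ≡⟨ cong suc (∣p∪q∣+∣p∩q∣≡∣p∣+∣q∣ p q) ⟩
  suc (∣ p ∣ + ∣ q ∣)       ≡⟨ sym (+-suc ∣ p ∣ ∣ q ∣) ⟩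
  ∣ p ∣ + suc ∣ q ∣         ∎)
  where open ≡-Reasoning

∣p∪q∣≤∣p∣+∣q∣ : ∀ (p q : Subset n) → ∣ p ∪ q ∣ ≤ ∣ p ∣ + ∣ q ∣
∣p∪q∣≤∣p∣+∣q∣ p q = subst (∣ p ∪ q ∣ ≤_) (∣p∪q∣+∣p∩q∣≡∣p∣+∣q∣ p q) (m≤m+n _ _)

∣p∪q∣≡∣p∣+∣q∣ : ∀ (p q : Subset n) → Empty (p ∩ q) → ∣ p ∪ q ∣ ≡ ∣ p ∣ + ∣ q ∣
∣p∪q∣≡∣p∣+∣q∣ {n} p q disjoint = begin
  ∣ p ∪ q ∣             ≡⟨ sym (+-identityʳ _) ⟩
  ∣ p ∪ q ∣ + 0         ≡⟨ cong (∣ p ∪ q ∣ +_) (sym ∣p∩q∣≡0) ⟩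
  ∣ p ∪ q ∣ + ∣ p ∩ q ∣ ≡⟨ ∣p∪q∣+∣p∩q∣≡∣p∣+∣q∣ p q ⟩
  ∣ p ∣ + ∣ q ∣         ∎
  where
  open ≡-Reasoning
  ∣p∩q∣≡0 : ∣ p ∩ q ∣ ≡ 0
  ∣p∩q∣≡0 = trans (cong ∣_∣ (Empty-unique disjoint)) (∣⊥∣≡0 n)

∣p∣≡1⇒x≡y : ∣ p ∣ ≡ 1 → x ∈ p → y ∈ p → x ≡ y
∣p∣≡1⇒x≡y {p = p} {x} {y} ∣p∣≡1 x∈p y∈p = decidable-stable (x ≟ y) λ x≢y →
  <⇒≱ (subst (∣ p ─ ⁅ x ⁆ ∣ <_) ∣p∣≡1 (p∩q≢∅⇒∣p─q∣<∣p∣ p ⁅ x ⁆ (x , x∈p∩q⁺ (x∈p , x∈⁅x⁆ x))))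
      (subst (_≤ ∣ p ─ ⁅ x ⁆ ∣) (∣⁅x⁆∣≡1 y) (p⊆q⇒∣p∣≤∣q∣ (⁅y⁆⊆p-x (x≢y ∘ sym))))
  where
  ⁅y⁆⊆p-x : y ≢ x → ∀ {z} → z ∈ ⁅ y ⁆ → z ∈ p ─ ⁅ x ⁆
  ⁅y⁆⊆p-x y≢x z∈⁅y⁆ = subst (_∈ p ─ ⁅ x ⁆) (sym (x∈⁅y⁆⇒x≡y y z∈⁅y⁆)) (x∈p∧x≢y⇒x∈p-y y∈p y≢x)

subsets : ∀ n → List (Subset n)
subsets ℕ.zero  = [ [] ]
subsets (suc n) = map (inside ∷_) (subsets n) ++ map (outside ∷_) (subsets n)

∈-subsets : ∀ (p : Subset n) → p ∈ˡ subsets n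
∈-subsets []            = here refl
∈-subsets (inside  ∷ p) = ∈-++⁺ˡ (∈-map⁺ (inside ∷_) (∈-subsets p))
∈-subsets (outside ∷ p) = ∈-++⁺ʳ (map (inside ∷_) (subsets _)) (∈-map⁺ (outside ∷_) (∈-subsets p))

module _ {ℓ : Level} {P : Pred (Subset n) ℓ} (P? : Decidable P) {S₀ : Subset n} (PS₀ : P S₀) where

  private
    candidates : List (Subset n)
    candidates = filter P? (subsets n)

    ∈-candidates : ∀ {T} → P T → T ∈ˡ candidates
    ∈-candidates {T} PT = ∈-filter⁺ P? (∈-subsets T) PT

  largest : Σ[ S ∈ Subset n ] P S × (∀ T → P T → ∣ T ∣ ≤ ∣ S ∣)
  largest = argmax ∣_∣ S₀ candidates
          , argmax-all ∣_∣ PS₀ (all-filter P? (subsets n))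
          , λ T PT → All.lookup (f[xs]≤f[argmax] {f = ∣_∣} S₀ candidates) (∈-candidates PT)

  smallest : Σ[ S ∈ Subset n ] P S × (∀ T → P T → ∣ S ∣ ≤ ∣ T ∣)
  smallest = argmin ∣_∣ S₀ candidates
           , argmin-all ∣_∣ PS₀ (all-filter P? (subsets n))
           , λ T PT → All.lookup (f[argmin]≤f[xs] {f = ∣_∣} S₀ candidates) (∈-candidates PT)

¬¬-Π-Fin : ∀ {ℓ} n {P : Pred (Fin n) ℓ} → (∀ i → ¬ ¬ P i) → ¬ ¬ (∀ i → P i)
¬¬-Π-Fin ℕ.zero  ¬¬P ¬∀P = ¬∀P λ ()
¬¬-Π-Fin (suc n) ¬¬P ¬∀P = ¬¬P zero λ P0 → ¬¬-Π-Fin n (¬¬P ∘ suc) λ ∀P →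
  ¬∀P λ { zero → P0 ; (suc i) → ∀P i }

¬¬-decidable : ∀ {ℓ} (R : Fin n → Fin n → Set ℓ) → ¬ ¬ (∀ x y → Dec (R x y))
¬¬-decidable {n} R = ¬¬-Π-Fin n λ x → ¬¬-Π-Fin n λ y → ¬¬-excluded-middle

module _ (G : Graph n) where
  open Graph G renaming (sym to Adj-sym)

  Independent-∪ : Independent G p → Independent G q →
                  (∀ x y → x ∈ p → y ∈ q → ¬ Adj x y) → Independent G (p ∪ q)
  Independent-∪ {p = p} {q} indP indQ noEdge x y x∈ y∈ with x∈p∪q⁻ p q x∈ | x∈p∪q⁻ p q y∈
  ... | inj₁ x∈p | inj₁ y∈p = indP x y x∈p y∈p
  ... | inj₁ x∈p | inj₂ y∈q = noEdge x y x∈p y∈q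
  ... | inj₂ x∈q | inj₁ y∈p = noEdge y x y∈p x∈q ∘ Adj-sym
  ... | inj₂ x∈q | inj₂ y∈q = indQ x y x∈q y∈q

  Independent-⁅⁆ : ∀ v → Independent G ⁅ v ⁆
  Independent-⁅⁆ v x y x∈ y∈ with refl ← x∈⁅y⁆⇒x≡y v x∈ | refl ← x∈⁅y⁆⇒x≡y v y∈ = irrefl

  ¬InU-Adj : ¬ InU G x → Adj x y → ¬ InU G y
  ¬InU-Adj ¬Ux xy Uy = ¬Ux λ a b x↝a x↝b → Uy a b (step (Adj-sym xy) x↝a) (step (Adj-sym xy) x↝b)

  leaf-neighbour-unique : ∀ {x v y} → Leaf G x → Adj x v → ¬ InU G v → Adj x y → y ≡ v
  leaf-neighbour-unique (¬Ux , N , N⇔ , ∣N∣≡1) xv ¬Uv xy =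
    ∣p∣≡1⇒x≡y ∣N∣≡1 (Equivalence.from (N⇔ _) (xy , ¬InU-Adj ¬Ux xy)) (Equivalence.from (N⇔ _) (xv , ¬Uv))

  ∅-independent : Independent G ∅
  ∅-independent x y x∈∅ = contradiction x∈∅ ∉⊥

  OutsideClosedNbhd : Fin n → Pred (Fin n) 0ℓ
  OutsideClosedNbhd v x = x ≢ v × ¬ Adj v x

  module _ (Adj? : ∀ x y → Dec (Adj x y)) where

    IndependentIn : Pred (Fin n) 0ℓ → Subset n → Set
    IndependentIn A S = Independent G S × (∀ x → x ∈ S → A x)

    independent? : Decidable (Independent G)
    independent? S = all? λ x → all? λ y → (x ∈? S) →-dec ((y ∈? S) →-dec ¬? (Adj? x y))

    independentIn? : ∀ {A} → Decidable A → Decidable (IndependentIn A)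
    independentIn? A? S = independent? S ×-dec all? λ x → (x ∈? S) →-dec A? x

    dominates? : ∀ S w → Dec (∃ λ u → u ∈ S × Adj w u)
    dominates? S w = any? λ u → (u ∈? S) ×-dec Adj? w u

    maximalIndependent? : Decidable (MaximalIndependent G)
    maximalIndependent? S = independent? S ×-dec all? λ w → ¬? (w ∈? S) →-dec dominates? S w

    maximumIndependentIn-dominates : ∀ {A S} → IndependentIn A S → (∀ T → IndependentIn A T → ∣ T ∣ ≤ ∣ S ∣) →
      ∀ w → A w → w ∉ S → ∃ λ u → u ∈ S × Adj w u
    maximumIndependentIn-dominates {A} {S} (indS , S⊆A) maximum w Aw w∉S with dominates? S w
    ... | yes dominated = dominated
    ... | no ¬dominated = contradiction (maximum (S ∪ ⁅ w ⁆) (indS+w , S+w⊆A)) (<⇒≱ grows)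
      where
      indS+w : Independent G (S ∪ ⁅ w ⁆)
      indS+w = Independent-∪ indS (Independent-⁅⁆ w) λ u y u∈S y∈⁅w⁆ uy →
        ¬dominated (u , u∈S , Adj-sym (subst (Adj u) (x∈⁅y⁆⇒x≡y w y∈⁅w⁆) uy))
      S+w⊆A : ∀ x → x ∈ S ∪ ⁅ w ⁆ → A x
      S+w⊆A x x∈ with x∈p∪q⁻ S ⁅ w ⁆ x∈
      ... | inj₁ x∈S    = S⊆A x x∈S
      ... | inj₂ x∈⁅w⁆ = subst A (sym (x∈⁅y⁆⇒x≡y w x∈⁅w⁆)) Aw
      disjoint : Empty (S ∩ ⁅ w ⁆)
      disjoint (x , x∈S∩w) with x∈p∩q⁻ S ⁅ w ⁆ x∈S∩w
      ... | x∈S , x∈⁅w⁆ = w∉S (subst (_∈ S) (x∈⁅y⁆⇒x≡y w x∈⁅w⁆) x∈S)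
      grows : ∣ S ∣ < ∣ S ∪ ⁅ w ⁆ ∣
      grows = subst (∣ S ∣ <_)
        (sym (trans (∣p∪q∣≡∣p∣+∣q∣ S ⁅ w ⁆ disjoint) (cong (∣ S ∣ +_) (∣⁅x⁆∣≡1 w))))
        (m<m+n ∣ S ∣ (s≤s z≤n))

    maximumIndependent : Σ[ S ∈ Subset n ] Independent G S × (∀ T → Independent G T → ∣ T ∣ ≤ ∣ S ∣)
    maximumIndependent = largest independent? ∅-independent

    maximum⇒maximalIndependent : ∀ {S} → Independent G S → (∀ T → Independent G T → ∣ T ∣ ≤ ∣ S ∣) →
      MaximalIndependent G S
    maximum⇒maximalIndependent indS maximum = indS , λ w →
      maximumIndependentIn-dominates {A = λ _ → ⊤} (indS , _) (λ T (indT , _) → maximum T indT) w tt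

    α-exists : ∃ (IsAlpha G)
    α-exists with maximumIndependent
    ... | S , indS , maximum = ∣ S ∣ , (S , indS , refl) , maximum

    i-exists : ∃ (IsI G)
    i-exists with maximumIndependent
    ... | S , indS , maximum with smallest maximalIndependent? (maximum⇒maximalIndependent indS maximum)
    ...   | M , maxM , minimum = ∣ M ∣ , (M , maxM , refl) , minimum

    ∪⁅v⁆-maximalIndependent : ∀ {v J} → IndependentIn (OutsideClosedNbhd v) J →
      (∀ T → IndependentIn (OutsideClosedNbhd v) T → ∣ T ∣ ≤ ∣ J ∣) → MaximalIndependent G (J ∪ ⁅ v ⁆)
    ∪⁅v⁆-maximalIndependent {v} {J} (indJ , J⊆far) maximum = independent , dominates
      where
      independent : Independent G (J ∪ ⁅ v ⁆)
      independent = Independent-∪ indJ (Independent-⁅⁆ v) λ x y x∈J y∈⁅v⁆ xy →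
        proj₂ (J⊆far x x∈J) (Adj-sym (subst (Adj x) (x∈⁅y⁆⇒x≡y v y∈⁅v⁆) xy))
      dominates : ∀ w → w ∉ J ∪ ⁅ v ⁆ → ∃ λ u → u ∈ J ∪ ⁅ v ⁆ × Adj w u
      dominates w w∉ with Adj? w v
      ... | yes wv = v , x∈p∪q⁺ (inj₂ (x∈⁅x⁆ v)) , wv
      ... | no ¬wv with maximumIndependentIn-dominates (indJ , J⊆far) maximum w (w≢v , ¬wv ∘ Adj-sym) (w∉ ∘ x∈p∪q⁺ ∘ inj₁)
        where
        w≢v : w ≢ v
        w≢v refl = w∉ (x∈p∪q⁺ (inj₂ (x∈⁅x⁆ w)))
      ...   | u , u∈J , wu = u , x∈p∪q⁺ (inj₁ u∈J) , wu

    leaves-≤-1+μ : ∀ {v L a b} → ¬ InU G v → (∀ x → x ∈ L → Leaf G x × Adj v x) →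
      IsAlpha G a → IsI G b → ∣ L ∣ ≤ suc (a ∸ b)
    leaves-≤-1+μ {v} {L} {a} {b} ¬Uv leavesL (_ , α-maximum) (_ , i-minimum)
      with largest (independentIn? far?) (∅-independent , λ x x∈∅ → contradiction x∈∅ ∉⊥)
      where
      far? : Decidable (OutsideClosedNbhd v)
      far? x = ¬? (x ≟ v) ×-dec ¬? (Adj? v x)
    ... | J , (indJ , J⊆far) , maximum = +-cancelˡ-≤ ∣ J ∣ _ _ (begin
      ∣ J ∣ + ∣ L ∣               ≡⟨ sym (∣p∪q∣≡∣p∣+∣q∣ J L J∩L-empty) ⟩
      ∣ J ∪ L ∣                   ≤⟨ α-maximum (J ∪ L) J∪L-independent ⟩
      a                           ≤⟨ m≤n+m∸n a b ⟩
      b + (a ∸ b)                 ≤⟨ +-monoˡ-≤ (a ∸ b) (i-minimum (J ∪ ⁅ v ⁆) (∪⁅v⁆-maximalIndependent (indJ , J⊆far) maximum)) ⟩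
      ∣ J ∪ ⁅ v ⁆ ∣ + (a ∸ b)     ≤⟨ +-monoˡ-≤ (a ∸ b) (∣p∪q∣≤∣p∣+∣q∣ J ⁅ v ⁆) ⟩
      ∣ J ∣ + ∣ ⁅ v ⁆ ∣ + (a ∸ b) ≡⟨ cong (λ k → ∣ J ∣ + k + (a ∸ b)) (∣⁅x⁆∣≡1 v) ⟩
      ∣ J ∣ + 1 + (a ∸ b)         ≡⟨ +-assoc ∣ J ∣ 1 (a ∸ b) ⟩
      ∣ J ∣ + suc (a ∸ b)         ∎)
      where
      open ≤-Reasoning
      only-neighbour : ∀ {x} → x ∈ L → ∀ y → Adj x y → y ≡ v
      only-neighbour x∈L y = leaf-neighbour-unique (proj₁ (leavesL _ x∈L)) (Adj-sym (proj₂ (leavesL _ x∈L))) ¬Uv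
      J∩L-empty : Empty (J ∩ L)
      J∩L-empty (x , x∈J∩L) with x∈p∩q⁻ J L x∈J∩L
      ... | x∈J , x∈L = proj₂ (J⊆far x x∈J) (proj₂ (leavesL x x∈L))
      L-independent : Independent G L
      L-independent x y x∈L y∈L xy = irrefl (subst (Adj v) (only-neighbour x∈L y xy) (proj₂ (leavesL y y∈L)))
      J∪L-independent : Independent G (J ∪ L)
      J∪L-independent = Independent-∪ indJ L-independent λ x y x∈J y∈L xy →
        proj₁ (J⊆far x x∈J) (only-neighbour y∈L x (Adj-sym xy))

corollary2p6 : ∀ {n : ℕ} (G : Graph n) → MuAlphaAtMostOne G →
    ∀ (v : Fin n) → Internal G v →
    ∀ (L : Subset n) → (∀ x → x ∈ L → Leaf G x × Graph.Adj G v x) →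
    ∣ L ∣ ≤ 2
corollary2p6 G μ≤1 v (¬Uv , _) L leavesL =
  decidable-stable (∣ L ∣ ≤? 2) (¬¬-map bound (¬¬-decidable (Graph.Adj G)))
  where
  bound : (∀ x y → Dec (Graph.Adj G x y)) → ∣ L ∣ ≤ 2
  bound Adj? with α-exists G Adj? | i-exists G Adj?
  ... | a , isα | b , isI = ≤-trans (leaves-≤-1+μ G Adj? ¬Uv leavesL isα isI) (s≤s (μ≤1 a b isα isI))
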